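{- Let $S$ be an LA-semigroup and $\gamma,\delta\in[0,1]$ with $\gamma<\delta$. A fuzzy subset $\mu$ of $S$ is an $(\in_\gamma,\in_\gamma\vee q_\delta)$-fuzzy interior ideal of $S$ if and only if for all $a,b,c\in S$: (i) $\mu(ab)\vee\gamma\geq\mu(a)\wedge\mu(b)\wedge\delta$, and (ii) $\mu((ac)b)\vee\gamma\geq\mu(c)\wedge\delta$.
   Context: An LA-semigroup is a non-empty set $S$ with a binary operation (juxtaposition) satisfying $(xy)z=(zy)x$ for all $x,y,z\in S$. A fuzzy subset is a map $\mu:S\to[0,1]$; $\vee,\wedge$ denote max, min. For $x\in S$, $t\in(0,1]$, $x_t$ is the fuzzy point with support $x$ and value $t$. $x_t\in_\gamma\mu$ means $\mu(x)\geq t>\gamma$; $x_t q_\delta\mu$ means $\mu(x)+t>2\delta$; $x_t\in_\gamma\vee q_\delta\mu$ means $x_t\in_\gamma\mu$ or $x_t q_\delta\mu$. $\mu$ is an $(\in_\gamma,\in_\gamma\vee q_\delta)$-fuzzy interior ideal of $S$ if for all $a,b,c\in S$ and $t,r\in(\gamma,1]$: $a_t,b_r\in_\gamma\mu$ implies $(ab)_{t\wedge r}\in_\gamma\vee q_\delta\mu$; and $c_t\in_\gamma\mu$ implies $((ac)b)_t\in_\gamma\vee q_\delta\mu$. -}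

module Defs where

open import Level using (0ℓ)
open import Data.Product using (Σ; ∃; _×_; _,_)
open import Data.Sum using (_⊎_)
open import Relation.Nullary using (¬_)
open import Relation.Binary.PropositionalEquality using (_≡_)
open import Relation.Binary.Definitions using (tri<; tri≈; tri>)
open import Relation.Binary.Structures using (IsStrictTotalOrder)
open import Algebra.Structures using (IsCommutativeRing)

-- The real numbers, axiomatised as a complete ordered field
-- (any model is isomorphic to ℝ, so quantifying over models is the
-- same as speaking about ℝ).

record RealField : Set₁ where
  infixl 6 _+_
  infixl 7 _*_
  infix 4 _<_ _≤_
  field
    ℝ   : Set
    _+_ : ℝ → ℝ → ℝ
    _*_ : ℝ → ℝ → ℝ
    -_  : ℝ → ℝ
    0ℝ  : ℝ
    1ℝ  : ℝ
    _<_ : ℝ → ℝ → Set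
    isCommutativeRing : IsCommutativeRing _≡_ _+_ _*_ -_ 0ℝ 1ℝ
    0≢1     : ¬ (0ℝ ≡ 1ℝ)
    *-inverse : ∀ x → ¬ (x ≡ 0ℝ) → ∃ λ y → x * y ≡ 1ℝ
    isStrictTotalOrder : IsStrictTotalOrder _≡_ _<_
    +-mono-< : ∀ {x y} z → x < y → x + z < y + z
    *-pos    : ∀ {x y} → 0ℝ < x → 0ℝ < y → 0ℝ < x * y

  _≤_ : ℝ → ℝ → Set
  x ≤ y = x < y ⊎ x ≡ y

  field
    complete : (P : ℝ → Set) → ∃ P → (∃ λ b → ∀ x → P x → x ≤ b) →
               ∃ λ s → (∀ x → P x → x ≤ s) × (∀ b → (∀ x → P x → x ≤ b) → s ≤ b)

  open IsStrictTotalOrder isStrictTotalOrder using (compare)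

  infixl 6 _∨_
  infixl 7 _∧_
  _∨_ : ℝ → ℝ → ℝ
  x ∨ y with compare x y
  ... | tri< _ _ _ = y
  ... | tri≈ _ _ _ = x
  ... | tri> _ _ _ = x

  _∧_ : ℝ → ℝ → ℝ
  x ∧ y with compare x y
  ... | tri< _ _ _ = x
  ... | tri≈ _ _ _ = x
  ... | tri> _ _ _ = y

  InUnit : ℝ → Set
  InUnit x = 0ℝ ≤ x × x ≤ 1ℝ

record LASemigroup : Set₁ where
  infixl 7 _∙_
  field
    Carrier      : Set
    _∙_          : Carrier → Carrier → Carrier
    leftInvertive : ∀ x y z → (x ∙ y) ∙ z ≡ (z ∙ y) ∙ x

module Fuzzy (R : RealField) (S : LASemigroup) where
  open RealField R
  open LASemigroup S

  IsFuzzySubset : (Carrier → ℝ) → Set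
  IsFuzzySubset μ = ∀ x → InUnit (μ x)

  ∈[_] : ℝ → (Carrier → ℝ) → Carrier → ℝ → Set
  ∈[ γ ] μ x t = t ≤ μ x × γ < t

  q[_] : ℝ → (Carrier → ℝ) → Carrier → ℝ → Set
  q[ δ ] μ x t = δ + δ < μ x + t

  ∈∨q[_,_] : ℝ → ℝ → (Carrier → ℝ) → Carrier → ℝ → Set
  ∈∨q[ γ , δ ] μ x t = ∈[ γ ] μ x t ⊎ q[ δ ] μ x t

  InHalfOpen : ℝ → ℝ → Set
  InHalfOpen γ t = γ < t × t ≤ 1ℝ

  IsInteriorIdeal : ℝ → ℝ → (Carrier → ℝ) → Set
  IsInteriorIdeal γ δ μ =
    (∀ a b t r → InHalfOpen γ t → InHalfOpen γ r →
       ∈[ γ ] μ a t → ∈[ γ ] μ b r → ∈∨q[ γ , δ ] μ (a ∙ b) (t ∧ r))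
    ×
    (∀ a b c t → InHalfOpen γ t →
       ∈[ γ ] μ c t → ∈∨q[ γ , δ ] μ ((a ∙ c) ∙ b) t)

-- Both conditions are instances of one pointwise fact: for w, v ∈ ℝ,
-- "every level t ∈ (γ,1] with t ≤ w satisfies (t ≤ v and t > γ) or v + t > 2δ"
-- holds iff w ∧ δ ≤ v ∨ γ. Levels t ≤ δ can only use the ∈γ-alternative, levels
-- t > δ are covered by qδ as soon as v ≥ δ, and testing the single level w ∧ δ
-- gives the converse. For products, a pair of levels t ≤ μ a, r ≤ μ b is
-- equivalent to the single level t ∧ r ≤ μ a ∧ μ b.
module Submission where

open import Defs
open import Level using (0ℓ)
open import Data.Product using (_×_; _,_; proj₁)
open import Data.Product.Function.NonDependent.Propositional using (_×-⇔_)
open import Data.Sum using (_⊎_; inj₁; inj₂)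
open import Function.Bundles using (_⇔_; mk⇔; Equivalence)
open import Relation.Nullary using (¬_; contradiction)
open import Relation.Binary.PropositionalEquality using (_≡_; refl; sym; subst)
open import Relation.Binary.Definitions using (tri<; tri≈; tri>)
open import Relation.Binary.Structures using (IsStrictTotalOrder)
open import Relation.Binary.Bundles using (TotalOrder)
open import Algebra.Structures using (IsCommutativeRing)
open import Algebra.Construct.NaturalChoice.Base using (MinOperator; MaxOperator)
import Relation.Binary.Construct.StrictToNonStrict as StrictToNonStrict
import Algebra.Construct.NaturalChoice.MinOp as MinOp
import Algebra.Construct.NaturalChoice.MaxOp as MaxOp

module OrderedFieldProperties (R : RealField) where
  open RealField R
  open IsStrictTotalOrder isStrictTotalOrder
    using (compare) renaming (trans to <-trans; irrefl to <-irrefl; asym to <-asym)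
    public
  open IsCommutativeRing isCommutativeRing using (+-comm)

  ≤-totalOrder : TotalOrder 0ℓ 0ℓ 0ℓ
  ≤-totalOrder = record { isTotalOrder = StrictToNonStrict.isTotalOrder _≡_ _<_ isStrictTotalOrder }

  open TotalOrder ≤-totalOrder public
    using (totalPreorder; antisym) renaming (refl to ≤-refl; trans to ≤-trans)

  ≤-or-> : ∀ x y → x ≤ y ⊎ y < x
  ≤-or-> x y with compare x y
  ... | tri< x<y _ _ = inj₁ (inj₁ x<y)
  ... | tri≈ _ x≡y _ = inj₁ (inj₂ x≡y)
  ... | tri> _ _ y<x = inj₂ y<x

  <⇒≤ : ∀ {x y} → x < y → x ≤ y
  <⇒≤ = inj₁

  <-≤-trans : ∀ {x y z} → x < y → y ≤ z → x < z
  <-≤-trans = StrictToNonStrict.<-≤-trans _≡_ _<_ <-trans (λ { refl p → p })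

  <⇒≱ : ∀ {x y} → x < y → ¬ (y ≤ x)
  <⇒≱ x<y (inj₁ y<x) = <-asym x<y y<x
  <⇒≱ x<y (inj₂ refl) = <-irrefl refl x<y

  ∧-minOperator : MinOperator totalPreorder
  ∧-minOperator = record { _⊓_ = _∧_ ; x≤y⇒x⊓y≈x = ≤⇒∧≡ˡ ; x≥y⇒x⊓y≈y = ≥⇒∧≡ʳ }
    where
    ≤⇒∧≡ˡ : ∀ {x y} → x ≤ y → x ∧ y ≡ x
    ≤⇒∧≡ˡ {x} {y} x≤y with compare x y
    ... | tri< _ _ _ = refl
    ... | tri≈ _ _ _ = refl
    ... | tri> _ _ y<x = antisym (<⇒≤ y<x) x≤y
    ≥⇒∧≡ʳ : ∀ {x y} → y ≤ x → x ∧ y ≡ y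
    ≥⇒∧≡ʳ {x} {y} y≤x with compare x y
    ... | tri< x<y _ _ = antisym (<⇒≤ x<y) y≤x
    ... | tri≈ _ x≡y _ = x≡y
    ... | tri> _ _ _ = refl

  ∨-maxOperator : MaxOperator totalPreorder
  ∨-maxOperator = record { _⊔_ = _∨_ ; x≤y⇒x⊔y≈y = ≤⇒∨≡ʳ ; x≥y⇒x⊔y≈x = ≥⇒∨≡ˡ }
    where
    ≤⇒∨≡ʳ : ∀ {x y} → x ≤ y → x ∨ y ≡ y
    ≤⇒∨≡ʳ {x} {y} x≤y with compare x y
    ... | tri< _ _ _ = refl
    ... | tri≈ _ x≡y _ = x≡y
    ... | tri> _ _ y<x = antisym x≤y (<⇒≤ y<x)
    ≥⇒∨≡ˡ : ∀ {x y} → y ≤ x → x ∨ y ≡ x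
    ≥⇒∨≡ˡ {x} {y} y≤x with compare x y
    ... | tri< x<y _ _ = antisym y≤x (<⇒≤ x<y)
    ... | tri≈ _ _ _ = refl
    ... | tri> _ _ _ = refl

  open MinOp ∧-minOperator public using (x⊓y≤x; x⊓y≤y; ⊓-glb; ⊓-idem; ⊓-sel; ⊓-mono-≤)
  open MaxOp ∨-maxOperator public using (x≤x⊔y; x≤y⊔x; ⊔-sel)

  <-∧ : ∀ {z x y} → z < x → z < y → z < x ∧ y
  <-∧ {z} {x} {y} z<x z<y with ⊓-sel x y
  ... | inj₁ eq = subst (z <_) (sym eq) z<x
  ... | inj₂ eq = subst (z <_) (sym eq) z<y

  ≤-∨-cancelʳ : ∀ {x v γ} → γ < x → x ≤ v ∨ γ → x ≤ v
  ≤-∨-cancelʳ {x} {v} {γ} γ<x x≤v∨γ with ⊔-sel v γ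
  ... | inj₁ eq = subst (x ≤_) eq x≤v∨γ
  ... | inj₂ eq = contradiction (subst (x ≤_) eq x≤v∨γ) (<⇒≱ γ<x)

  +-monoʳ-< : ∀ z {x y} → x < y → z + x < z + y
  +-monoʳ-< z {x} {y} x<y rewrite +-comm z x | +-comm z y = +-mono-< z x<y

  +-mono-<-≤ : ∀ {a b c d} → a < b → c ≤ d → a + c < b + d
  +-mono-<-≤ {b = b} a<b (inj₁ c<d) = <-trans (+-mono-< _ a<b) (+-monoʳ-< b c<d)
  +-mono-<-≤ a<b (inj₂ refl) = +-mono-< _ a<b

  +-mono-≤-< : ∀ {a b c d} → a ≤ b → c < d → a + c < b + d
  +-mono-≤-< {b = b} {c = c} (inj₁ a<b) c<d = <-trans (+-mono-< c a<b) (+-monoʳ-< b c<d)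
  +-mono-≤-< (inj₂ refl) c<d = +-monoʳ-< _ c<d

module FuzzyLevels (R : RealField) (S : LASemigroup)
                   (γ δ : RealField.ℝ R) (μ : LASemigroup.Carrier S → RealField.ℝ R) where
  open RealField R
  open LASemigroup S
  open Fuzzy R S
  open OrderedFieldProperties R

  q[δ]⇒≤ : ∀ {x t} → t ≤ δ → q[ δ ] μ x t → t ≤ μ x
  q[δ]⇒≤ {x} {t} t≤δ q with ≤-or-> t (μ x)
  ... | inj₁ t≤μx = t≤μx
  ... | inj₂ μx<t = contradiction q (<-asym (+-mono-<-≤ (<-≤-trans μx<t t≤δ) t≤δ))

  ≥δ⇒q[δ] : ∀ {x t} → δ ≤ μ x → δ < t → q[ δ ] μ x t
  ≥δ⇒q[δ] δ≤μx δ<t = +-mono-≤-< δ≤μx δ<t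

  ∈∨q-upTo : ℝ → Carrier → Set
  ∈∨q-upTo w x = ∀ t → InHalfOpen γ t → t ≤ w → ∈∨q[ γ , δ ] μ x t

  ProductClause : Set
  ProductClause = ∀ a b t r → InHalfOpen γ t → InHalfOpen γ r →
    ∈[ γ ] μ a t → ∈[ γ ] μ b r → ∈∨q[ γ , δ ] μ (a ∙ b) (t ∧ r)

  InteriorClause : Set
  InteriorClause = ∀ a b c t → InHalfOpen γ t →
    ∈[ γ ] μ c t → ∈∨q[ γ , δ ] μ ((a ∙ c) ∙ b) t

  module _ (γ<δ : γ < δ) (δ≤1 : δ ≤ 1ℝ) where

    ∈∨q-upTo⇔ : ∀ w x → ∈∨q-upTo w x ⇔ (w ∧ δ ≤ μ x ∨ γ)
    ∈∨q-upTo⇔ w x = mk⇔ at-level-w∧δ at-every-level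
      where
      at-level-w∧δ : ∈∨q-upTo w x → w ∧ δ ≤ μ x ∨ γ
      at-level-w∧δ h with ≤-or-> (w ∧ δ) γ
      ... | inj₁ w∧δ≤γ = ≤-trans w∧δ≤γ (x≤y⊔x (μ x) γ)
      ... | inj₂ γ<w∧δ with h (w ∧ δ) (γ<w∧δ , ≤-trans (x⊓y≤y w δ) δ≤1) (x⊓y≤x w δ)
      ...   | inj₁ (w∧δ≤μx , _) = ≤-trans w∧δ≤μx (x≤x⊔y (μ x) γ)
      ...   | inj₂ q = ≤-trans (q[δ]⇒≤ (x⊓y≤y w δ) q) (x≤x⊔y (μ x) γ)

      at-every-level : w ∧ δ ≤ μ x ∨ γ → ∈∨q-upTo w x
      at-every-level h t (γ<t , _) t≤w with ≤-or-> t δ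
      ... | inj₁ t≤δ = inj₁ (≤-∨-cancelʳ γ<t (≤-trans (⊓-glb t≤w t≤δ) h) , γ<t)
      ... | inj₂ δ<t = inj₂ (≥δ⇒q[δ] (≤-∨-cancelʳ γ<δ (≤-trans δ≤w∧δ h)) δ<t)
        where
        δ≤w∧δ : δ ≤ w ∧ δ
        δ≤w∧δ = ⊓-glb (<⇒≤ (<-≤-trans δ<t t≤w)) ≤-refl

    product-clause⇔ : ProductClause ⇔ (∀ a b → μ a ∧ μ b ∧ δ ≤ μ (a ∙ b) ∨ γ)
    product-clause⇔ = mk⇔ to from
      where
      to : ProductClause → ∀ a b → μ a ∧ μ b ∧ δ ≤ μ (a ∙ b) ∨ γ
      to h a b = Equivalence.to (∈∨q-upTo⇔ (μ a ∧ μ b) (a ∙ b)) λ t t∈ t≤μa∧μb →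
        subst (∈∨q[ γ , δ ] μ (a ∙ b)) (⊓-idem t)
          (h a b t t t∈ t∈ (≤-trans t≤μa∧μb (x⊓y≤x (μ a) (μ b)) , proj₁ t∈)
                           (≤-trans t≤μa∧μb (x⊓y≤y (μ a) (μ b)) , proj₁ t∈))

      from : (∀ a b → μ a ∧ μ b ∧ δ ≤ μ (a ∙ b) ∨ γ) → ProductClause
      from h a b t r (γ<t , t≤1) (γ<r , _) (t≤μa , _) (r≤μb , _) =
        Equivalence.from (∈∨q-upTo⇔ (μ a ∧ μ b) (a ∙ b)) (h a b)
          (t ∧ r) (<-∧ γ<t γ<r , ≤-trans (x⊓y≤x t r) t≤1) (⊓-mono-≤ t≤μa r≤μb)

    interior-clause⇔ : InteriorClause ⇔ (∀ a b c → μ c ∧ δ ≤ μ ((a ∙ c) ∙ b) ∨ γ)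
    interior-clause⇔ = mk⇔
      (λ h a b c → Equivalence.to (∈∨q-upTo⇔ (μ c) ((a ∙ c) ∙ b))
        λ t t∈ t≤μc → h a b c t t∈ (t≤μc , proj₁ t∈))
      (λ h a b c t t∈ (t≤μc , _) →
        Equivalence.from (∈∨q-upTo⇔ (μ c) ((a ∙ c) ∙ b)) (h a b c) t t∈ t≤μc)

mainTheorem14 : (R : RealField) (S : LASemigroup) →
    let open RealField R
        open LASemigroup S
        open Fuzzy R S
    in (γ δ : ℝ) → InUnit γ → InUnit δ → γ < δ →
       (μ : Carrier → ℝ) → IsFuzzySubset μ →
       IsInteriorIdeal γ δ μ ⇔
         ((∀ a b → μ a ∧ μ b ∧ δ ≤ μ (a ∙ b) ∨ γ) ×
          (∀ a b c → μ c ∧ δ ≤ μ ((a ∙ c) ∙ b) ∨ γ))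
mainTheorem14 R S γ δ _ (_ , δ≤1) γ<δ μ _ =
  product-clause⇔ γ<δ δ≤1 ×-⇔ interior-clause⇔ γ<δ δ≤1
  where open FuzzyLevels R S γ δ μ
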